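{- If $0\leq i\leq k-1$, then $\Psi(X_i)=X_{f(i)}$, where $\Psi=\phi_k^{l-k}\phi_l^{dr+k\frac{d(d-1)}{2}}\phi_k^{k-r}$ and $f:\{0,\ldots,k-1\}\to\{0,\ldots,k-1\}$ is given by $f(i)=(k-l+di)_+$ if $0\leq i\leq k-r-1$ and $f(i)=\left(k-(d+1)(k-i)\right)_+$ if $k-r\leq i\leq k-1$, with $(n)_+=\max(n,0)$.
   Context: Fix integers $2\leq k<l$. For $n\geq1$, an $n$-configuration is a sequence of nonnegative integers $(X(i))_{i\in\mathbb{Z}_- }$ (number of balls in bin $i$) with $\sum_i X(i)=n$ and such that for some $p\geq1$, $X(i)>0$ iff $i>-p$; it is written as the tuple $[X(-p+1),\ldots,X(0)]$ (bin $0$ is the rightmost). For $k\leq n$, the move $\phi_k$ acts on an $n$-configuration $X$ as follows: counting balls from right to left, add one ball to the bin immediately to the right of the bin containing the $k$-th ball, then delete one ball from the leftmost bin; if the $k$-th ball is already in the rightmost bin, create a new bin immediately to its right containing one ball and relabel the bins so the new bin has label $0$ (then delete one ball from the leftmost bin). Powers $\phi^m$ denote $m$-fold composition, and compositions act right to left. Write $l=kd+r$ with integers $d\geq1$ and $1\leq r\leq k$. Define the $l$-configurations: $X_0=[k,\ldots,k,r]$ ($d$ bins with $k$ balls, then a rightmost bin with $r$ balls); for $1\leq i\leq r-1$, $X_i=[i,k,\ldots,k,r-i]$ with $d$ bins containing $k$ balls in the middle; for $r\leq i\leq k-1$, $X_i=[i,k,\ldots,k,k+r-i]$ with $d-1$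 bins containing $k$ balls in the middle. -}

module Defs where

open import Data.Nat using (ℕ; zero; suc; _+_; _*_; _∸_; _≤?_; _<?_)
open import Data.Nat.DivMod using (_/_)
open import Data.List using (List; []; _∷_; _++_; reverse; replicate)
open import Relation.Nullary using (yes; no)

-- A configuration is written, as in the paper, as the list
-- [X(-p+1), ..., X(0)] of bin contents from left to right
-- (all entries positive; bin 0 is the last entry).

-- Internally we work on the reversed list (rightmost bin first).

-- addAfter k x ys : x is the bin immediately to the right of the head of ys;
-- k is the number of balls still to count (from the right) starting at ys.
addAfter : ℕ → ℕ → List ℕ → List ℕ
addAfter k x [] = x ∷ []
addAfter k x (y ∷ ys) with k ≤? y
... | yes _ = suc x ∷ y ∷ ys
... | no  _ = x ∷ addAfter (k ∸ y) y ys

-- Add one ball to the bin immediately right of the bin containing the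
-- k-th ball counted from the right (creating a new rightmost bin if the
-- k-th ball is in the rightmost bin). Input/output: rightmost bin first.
addBall : ℕ → List ℕ → List ℕ
addBall k [] = []
addBall k (x ∷ xs) with k ≤? x
... | yes _ = 1 ∷ x ∷ xs
... | no  _ = addAfter (k ∸ x) x xs

-- Delete one ball from the leftmost bin (the last entry of a
-- rightmost-first list), removing the bin if it becomes empty.
removeLeft : List ℕ → List ℕ
removeLeft [] = []
removeLeft (zero ∷ []) = []
removeLeft (suc zero ∷ []) = []
removeLeft (suc (suc x) ∷ []) = suc x ∷ []
removeLeft (x ∷ y ∷ ys) = x ∷ removeLeft (y ∷ ys)

φ : ℕ → List ℕ → List ℕ
φ k X = reverse (removeLeft (addBall k (reverse X)))

iter : {A : Set} → ℕ → (A → A) → A → A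
iter zero    g x = x
iter (suc m) g x = g (iter m g x)

Ψ : (k l d r : ℕ) → List ℕ → List ℕ
Ψ k l d r X =
  iter (l ∸ k) (φ k) (iter (d * r + k * ((d * (d ∸ 1)) / 2)) (φ l) (iter (k ∸ r) (φ k) X))

-- The l-configurations X_i (l = kd + r)
Xc : (k d r i : ℕ) → List ℕ
Xc k d r zero = replicate d k ++ (r ∷ [])
Xc k d r (suc j) with suc j <? r
... | yes _ = suc j ∷ (replicate d k ++ ((r ∸ suc j) ∷ []))
... | no  _ = suc j ∷ (replicate (d ∸ 1) k ++ ((k + r ∸ suc j) ∷ []))

-- f(i) = (k - l + d i)_+  if i ≤ k-r-1,  (k - (d+1)(k-i))_+ otherwise
-- (truncated subtraction ∸ realises (n)_+ = max(n,0)).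
f : (k l d r i : ℕ) → ℕ
f k l d r i with i <? k ∸ r
... | yes _ = (k + d * i) ∸ l
... | no  _ = k ∸ (suc d * (k ∸ i))

-- Read configurations from the rightmost bin leftwards. Then X_j is a greedy packing of l - j balls
-- into bins of size k followed by a leftmost bin of j balls, and φ_k merely moves one ball from that
-- leftmost bin into the packing; hence φ_k^(k-r) sends X_i to X_(i+r), indices taken mod k. Since l is
-- the total number of balls, φ_l moves one ball from the leftmost bin to its neighbour, so the
-- dr + k d(d-1)/2 moves of φ_l merge all bins but the rightmost into one and then pour into the
-- rightmost bin, leaving two bins; the rightmost holds b = d(k - i) + r balls if i ≤ k - r and
-- b = (d + 1)(k - i) otherwise. Finally φ_k^(l-k) repacks these two bins into X_((k-b)_+), and
-- (k - b)_+ = f(i).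
module Submission where

open import Defs
open import Data.Nat using (NonZero; >-nonZero; ℕ; zero; suc; _+_; _*_; _∸_; _≤_; _<_; z≤n; s≤s; _≤?_; _<?_)
open import Data.Nat.Properties
open import Data.Nat.Tactic.RingSolver using (solve-∀)
open import Data.Nat.ListAction using (sum)
open import Data.Nat.ListAction.Properties using (sum-++)
open import Data.List using (List; []; _∷_; _++_; reverse; replicate)
open import Data.List.Properties using (++-assoc; ++-identityʳ; reverse-++; reverse-involutive; unfold-reverse)
open import Data.Product using (_×_; _,_; proj₁; proj₂)
open import Data.Nat.DivMod using (_/_; _%_; m≡m%n+[m/n]*n; m%n<n; m*n/n≡m)
open import Relation.Nullary using (yes; no; contradiction)
open import Relation.Binary.PropositionalEquality
open ≡-Reasoning

iter-+ : ∀ {A : Set} m n (g : A → A) x → iter (m + n) g x ≡ iter m g (iter n g x)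
iter-+ zero    n g x = refl
iter-+ (suc m) n g x = cong g (iter-+ m n g x)

replicate-∷ʳ : ∀ {A : Set} n (x : A) → replicate (suc n) x ≡ replicate n x ++ x ∷ []
replicate-∷ʳ zero    x = refl
replicate-∷ʳ (suc n) x = cong (x ∷_) (replicate-∷ʳ n x)

reverse-replicate : ∀ {A : Set} n (x : A) → reverse (replicate n x) ≡ replicate n x
reverse-replicate zero    x = refl
reverse-replicate (suc n) x = begin
  reverse (x ∷ replicate n x)       ≡⟨ unfold-reverse x (replicate n x) ⟩
  reverse (replicate n x) ++ x ∷ [] ≡⟨ cong (_++ x ∷ []) (reverse-replicate n x) ⟩
  replicate n x ++ x ∷ []           ≡⟨ sym (replicate-∷ʳ n x) ⟩
  replicate (suc n) x               ∎

sum-replicate : ∀ n x → sum (replicate n x) ≡ n * x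
sum-replicate zero    x = refl
sum-replicate (suc n) x = cong (x +_) (sum-replicate n x)

m∸n<m : ∀ {m n} → 0 < m → 0 < n → m ∸ n < m
m∸n<m {suc m} {suc n} _ _ = s≤s (m∸n≤m m n)

triangular : ℕ → ℕ
triangular zero    = 0
triangular (suc n) = n + triangular n

twice-triangular : ∀ d → d * (d ∸ 1) ≡ triangular d * 2
twice-triangular zero          = refl
twice-triangular (suc zero)    = refl
twice-triangular (suc (suc d)) =
  trans (expand d) (trans (cong (suc d * 2 +_) (twice-triangular (suc d)))
                          (sym (*-distribʳ-+ 2 (suc d) (triangular (suc d)))))
  where
  expand : ∀ d → suc (suc d) * suc d ≡ suc d * 2 + suc d * d
  expand = solve-∀

half-pronic : ∀ d → d * (d ∸ 1) / 2 ≡ triangular d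
half-pronic d = trans (cong (_/ 2) (twice-triangular d)) (m*n/n≡m (triangular d) 2)

φʳ : ℕ → List ℕ → List ℕ
φʳ c R = removeLeft (addBall c R)

iter-φ-reverse : ∀ c n R → iter n (φ c) (reverse R) ≡ reverse (iter n (φʳ c) R)
iter-φ-reverse c zero    R = refl
iter-φ-reverse c (suc n) R = begin
  reverse (φʳ c (reverse (iter n (φ c) (reverse R))))
    ≡⟨ cong (λ X → reverse (φʳ c (reverse X))) (iter-φ-reverse c n R) ⟩
  reverse (φʳ c (reverse (reverse (iter n (φʳ c) R))))
    ≡⟨ cong (λ R′ → reverse (φʳ c R′)) (reverse-involutive (iter n (φʳ c) R)) ⟩
  reverse (φʳ c (iter n (φʳ c) R)) ∎

bin : ℕ → List ℕ
bin zero    = []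
bin (suc n) = suc n ∷ []

reverse-bin : ∀ n → reverse (bin n) ≡ bin n
reverse-bin zero    = refl
reverse-bin (suc n) = refl

bump : List ℕ → List ℕ
bump []           = 1 ∷ []
bump (x ∷ [])     = suc x ∷ []
bump (x ∷ y ∷ ys) = x ∷ bump (y ∷ ys)

bump-∷ʳ : ∀ ys x → bump (ys ++ x ∷ []) ≡ ys ++ suc x ∷ []
bump-∷ʳ []           x = refl
bump-∷ʳ (y ∷ [])     x = refl
bump-∷ʳ (y ∷ z ∷ ys) x = cong (y ∷_) (bump-∷ʳ (z ∷ ys) x)

∸-bounds : ∀ {x s c y} → x + s < c → c ≤ x + s + y → s < c ∸ x × c ∸ x ≤ s + y
∸-bounds {x} {s} {c} {y} lo hi =
  m+n≤o⇒m≤o∸n (suc s) (subst (_≤ c) (cong suc (+-comm x s)) lo) ,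
  m≤n+o⇒m∸n≤o c x (subst (c ≤_) (+-assoc x s y) hi)

addAfter-split : ∀ c x ys y zs → sum ys < c → c ≤ sum ys + y →
  addAfter c x (ys ++ y ∷ zs) ≡ bump (x ∷ ys) ++ y ∷ zs
addAfter-split c x [] y zs lo hi with c ≤? y
... | yes _  = refl
... | no c≰y = contradiction hi c≰y
addAfter-split c x (y′ ∷ ys) y zs lo hi with c ≤? y′
... | yes c≤y′ = contradiction (<-≤-trans lo c≤y′) (m+n≮m y′ (sum ys))
... | no _     = cong (x ∷_) (addAfter-split (c ∸ y′) y′ ys y zs (proj₁ b) (proj₂ b))
  where b = ∸-bounds {y′} {sum ys} {c} {y} lo hi

-- The hypotheses say that the c-th ball lies in bin y, so the new ball goes to the last bin of ys.
addBall-split : ∀ c ys y zs → sum ys < c → c ≤ sum ys + y →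
  addBall c (ys ++ y ∷ zs) ≡ bump ys ++ y ∷ zs
addBall-split c [] y zs lo hi with c ≤? y
... | yes _  = refl
... | no c≰y = contradiction hi c≰y
addBall-split c (x ∷ ys) y zs lo hi with c ≤? x
... | yes c≤x = contradiction (<-≤-trans lo c≤x) (m+n≮m x (sum ys))
... | no _    = addAfter-split (c ∸ x) x ys y zs (proj₁ b) (proj₂ b)
  where b = ∸-bounds {x} {sum ys} {c} {y} lo hi

removeLeft-∷ : ∀ x y ys → removeLeft (x ∷ y ∷ ys) ≡ x ∷ removeLeft (y ∷ ys)
removeLeft-∷ zero          y ys = refl
removeLeft-∷ (suc zero)    y ys = refl
removeLeft-∷ (suc (suc x)) y ys = refl

removeLeft-++ : ∀ xs y ys → removeLeft (xs ++ y ∷ ys) ≡ xs ++ removeLeft (y ∷ ys)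
removeLeft-++ []            y ys = refl
removeLeft-++ (x ∷ [])      y ys = removeLeft-∷ x y ys
removeLeft-++ (x ∷ x′ ∷ xs) y ys =
  trans (removeLeft-∷ x x′ (xs ++ y ∷ ys)) (cong (x ∷_) (removeLeft-++ (x′ ∷ xs) y ys))

removeLeft-bin : ∀ n → removeLeft (suc n ∷ []) ≡ bin n
removeLeft-bin zero    = refl
removeLeft-bin (suc n) = refl

-- When c is the total number of balls, the c-th ball is in the leftmost bin, so φ_c moves a ball
-- from the leftmost bin to its neighbour.
φʳ-pour : ∀ {c} ys b a → sum ys + (b + suc a) ≡ c →
  φʳ c (ys ++ b ∷ suc a ∷ []) ≡ ys ++ suc b ∷ bin a
φʳ-pour {c} ys b a total = begin
  removeLeft (addBall c (ys ++ b ∷ suc a ∷ []))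
    ≡⟨ cong (λ R → removeLeft (addBall c R)) (sym (++-assoc ys (b ∷ []) (suc a ∷ []))) ⟩
  removeLeft (addBall c ((ys ++ b ∷ []) ++ suc a ∷ []))
    ≡⟨ cong removeLeft (addBall-split c (ys ++ b ∷ []) (suc a) [] s<c (≤-reflexive (sym s+1+a≡c))) ⟩
  removeLeft (bump (ys ++ b ∷ []) ++ suc a ∷ [])
    ≡⟨ cong (λ R → removeLeft (R ++ suc a ∷ [])) (bump-∷ʳ ys b) ⟩
  removeLeft ((ys ++ suc b ∷ []) ++ suc a ∷ [])
    ≡⟨ removeLeft-++ (ys ++ suc b ∷ []) (suc a) [] ⟩
  (ys ++ suc b ∷ []) ++ removeLeft (suc a ∷ [])
    ≡⟨ cong ((ys ++ suc b ∷ []) ++_) (removeLeft-bin a) ⟩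
  (ys ++ suc b ∷ []) ++ bin a
    ≡⟨ ++-assoc ys (suc b ∷ []) (bin a) ⟩
  ys ++ suc b ∷ bin a ∎
  where
  s = sum (ys ++ b ∷ [])
  s+1+a≡c : s + suc a ≡ c
  s+1+a≡c = trans (cong (_+ suc a) (trans (sum-++ ys (b ∷ [])) (cong (sum ys +_) (+-identityʳ b))))
                  (trans (+-assoc (sum ys) b (suc a)) total)
  s<c : s < c
  s<c = <-≤-trans (m<m+n s 0<1+n) (≤-reflexive s+1+a≡c)

pour : ∀ {c} ys b a t → sum ys + (b + (a + t)) ≡ c →
  iter t (φʳ c) (ys ++ b ∷ bin (a + t)) ≡ ys ++ (b + t) ∷ bin a
pour ys b a zero    total = cong₂ (λ u v → ys ++ u ∷ bin v) (sym (+-identityʳ b)) (+-identityʳ a)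
pour {c} ys b a (suc t) total = begin
  φʳ c (iter t (φʳ c) (ys ++ b ∷ bin (a + suc t)))
    ≡⟨ cong (λ n → φʳ c (iter t (φʳ c) (ys ++ b ∷ bin n))) (+-suc a t) ⟩
  φʳ c (iter t (φʳ c) (ys ++ b ∷ bin (suc a + t)))
    ≡⟨ cong (φʳ c) (pour ys b (suc a) t (trans (cong (λ n → sum ys + (b + n)) (sym (+-suc a t))) total)) ⟩
  φʳ c (ys ++ (b + t) ∷ suc a ∷ [])
    ≡⟨ φʳ-pour ys (b + t) a (trans (cong (sum ys +_) (regroup b a t)) total) ⟩
  ys ++ suc (b + t) ∷ bin a
    ≡⟨ cong (λ u → ys ++ u ∷ bin a) (sym (+-suc b t)) ⟩
  ys ++ (b + suc t) ∷ bin a ∎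
  where
  regroup : ∀ b a t → b + t + suc a ≡ b + (a + suc t)
  regroup = solve-∀

-- The leftmost bin is emptied into its neighbour q times, holding a + 1, w + a + 1, 2w + a + 1, … balls.
pour-block : ∀ {c} ys w q a → sum ys + (q * w + suc a) ≡ c →
  iter (q * suc a + w * triangular q) (φʳ c) (ys ++ replicate q w ++ suc a ∷ [])
    ≡ ys ++ bin (q * w + suc a)
pour-block {c} ys w zero a total = cong (λ n → iter n (φʳ c) (ys ++ suc a ∷ [])) (*-zeroʳ w)
pour-block {c} ys w (suc q) a total = begin
  iter (suc q * suc a + w * triangular (suc q)) (φʳ c) (ys ++ replicate (suc q) w ++ suc a ∷ [])
    ≡⟨ cong₂ (λ n R → iter n (φʳ c) R) (count w q a (triangular q)) regroup-list ⟩
  iter (m + suc a) (φʳ c) ((ys ++ replicate q w) ++ w ∷ bin (0 + suc a))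
    ≡⟨ iter-+ m (suc a) (φʳ c) _ ⟩
  iter m (φʳ c) (iter (suc a) (φʳ c) ((ys ++ replicate q w) ++ w ∷ bin (0 + suc a)))
    ≡⟨ cong (iter m (φʳ c)) (pour (ys ++ replicate q w) w 0 (suc a) first-total) ⟩
  iter m (φʳ c) ((ys ++ replicate q w) ++ (w + suc a) ∷ [])
    ≡⟨ cong (iter m (φʳ c)) reassociate ⟩
  iter m (φʳ c) (ys ++ replicate q w ++ suc (w + a) ∷ [])
    ≡⟨ pour-block ys w q (w + a) (trans (cong (sum ys +_) (absorb w q a)) total) ⟩
  ys ++ bin (q * w + suc (w + a))
    ≡⟨ cong (λ n → ys ++ bin n) (absorb w q a) ⟩
  ys ++ bin (suc q * w + suc a) ∎
  where
  m = q * suc (w + a) + w * triangular q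
  count : ∀ w q a T → suc q * suc a + w * (q + T) ≡ q * suc (w + a) + w * T + suc a
  count = solve-∀
  absorb : ∀ w q a → q * w + suc (w + a) ≡ suc q * w + suc a
  absorb = solve-∀
  regroup-list : ys ++ replicate (suc q) w ++ suc a ∷ [] ≡ (ys ++ replicate q w) ++ w ∷ suc a ∷ []
  regroup-list = begin
    ys ++ replicate (suc q) w ++ suc a ∷ []
      ≡⟨ cong (λ R → ys ++ R ++ suc a ∷ []) (replicate-∷ʳ q w) ⟩
    ys ++ (replicate q w ++ w ∷ []) ++ suc a ∷ []
      ≡⟨ cong (ys ++_) (++-assoc (replicate q w) (w ∷ []) (suc a ∷ [])) ⟩
    ys ++ replicate q w ++ w ∷ suc a ∷ []
      ≡⟨ sym (++-assoc ys (replicate q w) _) ⟩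
    (ys ++ replicate q w) ++ w ∷ suc a ∷ [] ∎
  reassociate : (ys ++ replicate q w) ++ (w + suc a) ∷ [] ≡ ys ++ replicate q w ++ suc (w + a) ∷ []
  reassociate = trans (++-assoc ys (replicate q w) _) (cong (λ u → ys ++ replicate q w ++ u ∷ []) (+-suc w a))
  first-total : sum (ys ++ replicate q w) + (w + (0 + suc a)) ≡ c
  first-total = trans (cong (_+ (w + suc a)) (trans (sum-++ ys (replicate q w))
                                                    (cong (sum ys +_) (sum-replicate q w))))
                      (trans (sum-regroup (sum ys) q w a) total)
    where
    sum-regroup : ∀ s q w a → s + q * w + (w + suc a) ≡ s + (suc q * w + suc a)
    sum-regroup = solve-∀

pour-onto-rightmost : ∀ {c} e w q j t a → e + (q * w + suc j) ≡ c → t + a ≡ q * w + suc j →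
  iter (t + (q * suc j + w * triangular q)) (φʳ c) (e ∷ replicate q w ++ suc j ∷ [])
    ≡ (e + t) ∷ bin a
pour-onto-rightmost {c} e w q j t a total t+a = begin
  iter (t + (q * suc j + w * triangular q)) (φʳ c) (e ∷ replicate q w ++ suc j ∷ [])
    ≡⟨ iter-+ t _ (φʳ c) _ ⟩
  iter t (φʳ c) (iter (q * suc j + w * triangular q) (φʳ c) ((e ∷ []) ++ replicate q w ++ suc j ∷ []))
    ≡⟨ cong (iter t (φʳ c)) (pour-block (e ∷ []) w q j (trans (cong (_+ _) (+-identityʳ e)) total)) ⟩
  iter t (φʳ c) (e ∷ bin (q * w + suc j))
    ≡⟨ cong (λ n → iter t (φʳ c) (e ∷ bin n)) (sym (trans (+-comm a t) t+a)) ⟩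
  iter t (φʳ c) ([] ++ e ∷ bin (a + t))
    ≡⟨ pour [] e a t (trans (cong (λ n → e + n) (trans (+-comm a t) t+a)) total) ⟩
  (e + t) ∷ bin a ∎

module Packing (k : ℕ) where

  inc : List ℕ → List ℕ
  inc []       = 1 ∷ []
  inc (s ∷ xs) with s <? k
  ... | yes _ = suc s ∷ xs
  ... | no  _ = 1 ∷ s ∷ xs

  -- m balls, rightmost bin first, every bin but the rightmost one holding exactly k balls.
  pack : ℕ → List ℕ
  pack zero    = []
  pack (suc m) = inc (pack m)

  inc-< : ∀ {s} xs → s < k → inc (s ∷ xs) ≡ suc s ∷ xs
  inc-< {s} xs s<k with s <? k
  ... | yes _   = refl
  ... | no  s≮k = contradiction s<k s≮k

  inc-++ : ∀ xs ys → inc (xs ++ k ∷ ys) ≡ inc xs ++ k ∷ ys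
  inc-++ [] ys with k <? k
  ... | yes k<k = contradiction k<k (<-irrefl refl)
  ... | no  _   = refl
  inc-++ (x ∷ xs) ys with x <? k
  ... | yes _ = refl
  ... | no  _ = refl

  pack-small : ∀ s → 1 ≤ s → s ≤ k → pack s ≡ s ∷ []
  pack-small (suc zero)    _ _     = refl
  pack-small (suc (suc s)) _ 2+s≤k =
    trans (cong inc (pack-small (suc s) (s≤s z≤n) (<⇒≤ 2+s≤k))) (inc-< [] 2+s≤k)

  pack-+k : 1 ≤ k → ∀ m → pack (m + k) ≡ pack m ++ k ∷ []
  pack-+k 1≤k zero    = pack-small k 1≤k ≤-refl
  pack-+k 1≤k (suc m) = trans (cong inc (pack-+k 1≤k m)) (inc-++ (pack m) [])

  pack-full : ∀ q s → 1 ≤ s → s ≤ k → pack (q * k + s) ≡ s ∷ replicate q k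
  pack-full zero    s 1≤s s≤k = pack-small s 1≤s s≤k
  pack-full (suc q) s 1≤s s≤k = begin
    pack (k + q * k + s)        ≡⟨ cong pack (trans (+-assoc k (q * k) s) (+-comm k (q * k + s))) ⟩
    pack (q * k + s + k)        ≡⟨ pack-+k (≤-trans 1≤s s≤k) (q * k + s) ⟩
    pack (q * k + s) ++ k ∷ []  ≡⟨ cong (_++ k ∷ []) (pack-full q s 1≤s s≤k) ⟩
    s ∷ replicate q k ++ k ∷ [] ≡⟨ cong (s ∷_) (sym (replicate-∷ʳ q k)) ⟩
    s ∷ replicate (suc q) k     ∎

  addBall-inc : ∀ q s d D → 1 ≤ s → s ≤ k → k ≤ q * k + s + d →
    addBall k ((s ∷ replicate q k) ++ d ∷ D) ≡ inc (s ∷ replicate q k) ++ d ∷ D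
  addBall-inc q s d D 1≤s s≤k k≤total with s <? k
  addBall-inc zero    s d D _ s≤k k≤s+d | yes s<k =
    addBall-split k (s ∷ []) d D (subst (_< k) (sym (+-identityʳ s)) s<k)
                                 (subst (λ n → k ≤ n + d) (sym (+-identityʳ s)) k≤s+d)
  addBall-inc (suc q) s d D _ s≤k _     | yes s<k =
    addBall-split k (s ∷ []) k (replicate q k ++ d ∷ D) (subst (_< k) (sym (+-identityʳ s)) s<k)
                                                        (m≤n+m k (s + 0))
  ... | no s≮k = addBall-split k [] s _ (≤-trans 1≤s s≤k) (≮⇒≥ s≮k)

  addBall-pack : 1 ≤ k → ∀ m d D → k ≤ m + d → addBall k (pack m ++ d ∷ D) ≡ pack (suc m) ++ d ∷ D
  addBall-pack 1≤k zero    d D k≤d = addBall-split k [] d D 1≤k k≤d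
  addBall-pack 1≤k (suc m) d D k≤1+m+d =
    subst (λ P → addBall k (P ++ d ∷ D) ≡ inc P ++ d ∷ D) (sym shape)
          (addBall-inc q s d D (s≤s z≤n) s≤k (subst (λ n → k ≤ n + d) division k≤1+m+d))
    where
    instance
      k≢0 : NonZero k
      k≢0 = >-nonZero 1≤k
    q = m / k
    s = suc (m % k)
    s≤k : s ≤ k
    s≤k = m%n<n m k
    division : suc m ≡ q * k + s
    division = trans (cong suc (trans (m≡m%n+[m/n]*n m k) (+-comm (m % k) (q * k))))
                     (sym (+-suc (q * k) (m % k)))
    shape : pack (suc m) ≡ s ∷ replicate q k
    shape = trans (cong pack division) (pack-full q s (s≤s z≤n) s≤k)

  -- k ≤ m + d keeps the k-th ball inside the packing or the bin d after it.
  φʳ-pack : 1 ≤ k → ∀ m d D → k ≤ m + d → φʳ k (pack m ++ d ∷ D) ≡ pack (suc m) ++ removeLeft (d ∷ D)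
  φʳ-pack 1≤k m d D k≤m+d =
    trans (cong removeLeft (addBall-pack 1≤k m d D k≤m+d)) (removeLeft-++ (pack (suc m)) d D)

  drain : 1 ≤ k → ∀ m x n → k ≤ m + (x + n) →
    iter n (φʳ k) (pack m ++ bin (x + n)) ≡ pack (m + n) ++ bin x
  drain 1≤k m x zero    _   = cong₂ (λ u v → pack u ++ bin v) (sym (+-identityʳ m)) (+-identityʳ x)
  drain 1≤k m x (suc n) k≤l = begin
    φʳ k (iter n (φʳ k) (pack m ++ bin (x + suc n)))
      ≡⟨ cong (λ u → φʳ k (iter n (φʳ k) (pack m ++ bin u))) (+-suc x n) ⟩
    φʳ k (iter n (φʳ k) (pack m ++ bin (suc x + n)))
      ≡⟨ cong (φʳ k) (drain 1≤k m (suc x) n (subst (λ u → k ≤ m + u) (+-suc x n) k≤l)) ⟩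
    φʳ k (pack (m + n) ++ suc x ∷ [])
      ≡⟨ φʳ-pack 1≤k (m + n) (suc x) [] (subst (k ≤_) (regroup m x n) k≤l) ⟩
    pack (suc (m + n)) ++ removeLeft (suc x ∷ [])
      ≡⟨ cong₂ (λ u R → pack u ++ R) (sym (+-suc m n)) (removeLeft-bin x) ⟩
    pack (m + suc n) ++ bin x ∎
    where
    regroup : ∀ m x n → m + (x + suc n) ≡ m + n + suc x
    regroup = solve-∀

  drain-behind : 1 ≤ k → ∀ m b x n → k ≤ m + b →
    iter n (φʳ k) (pack m ++ b ∷ bin (x + n)) ≡ pack (m + n) ++ b ∷ bin x
  drain-behind 1≤k m b x zero    _     =
    cong₂ (λ u v → pack u ++ b ∷ bin v) (sym (+-identityʳ m)) (+-identityʳ x)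
  drain-behind 1≤k m b x (suc n) k≤m+b = begin
    φʳ k (iter n (φʳ k) (pack m ++ b ∷ bin (x + suc n)))
      ≡⟨ cong (λ u → φʳ k (iter n (φʳ k) (pack m ++ b ∷ bin u))) (+-suc x n) ⟩
    φʳ k (iter n (φʳ k) (pack m ++ b ∷ bin (suc x + n)))
      ≡⟨ cong (φʳ k) (drain-behind 1≤k m b (suc x) n k≤m+b) ⟩
    φʳ k (pack (m + n) ++ b ∷ suc x ∷ [])
      ≡⟨ φʳ-pack 1≤k (m + n) b (suc x ∷ []) (≤-trans k≤m+b (+-monoˡ-≤ b (m≤m+n m n))) ⟩
    pack (suc (m + n)) ++ removeLeft (b ∷ suc x ∷ [])
      ≡⟨ cong₂ (λ u R → pack u ++ R) (sym (+-suc m n))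
               (trans (removeLeft-∷ b (suc x) []) (cong (b ∷_) (removeLeft-bin x))) ⟩
    pack (m + suc n) ++ b ∷ bin x ∎

open Packing using (pack; pack-+k; pack-small; pack-full; drain; drain-behind)

-- X_j written rightmost bin first, for l = kd + r: the leftmost bin holds j balls, the rest are packed.
Xʳ : ℕ → ℕ → ℕ → List ℕ
Xʳ k l j = pack k (l ∸ j) ++ bin j

reverse-Xʳ : ∀ k l j q s → l ∸ j ≡ q * k + s → 1 ≤ s → s ≤ k →
  reverse (Xʳ k l j) ≡ bin j ++ replicate q k ++ s ∷ []
reverse-Xʳ k l j q s l∸j 1≤s s≤k = begin
  reverse (pack k (l ∸ j) ++ bin j)
    ≡⟨ cong (λ P → reverse (P ++ bin j)) (trans (cong (pack k) l∸j) (pack-full k q s 1≤s s≤k)) ⟩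
  reverse (s ∷ replicate q k ++ bin j)
    ≡⟨ unfold-reverse s (replicate q k ++ bin j) ⟩
  reverse (replicate q k ++ bin j) ++ s ∷ []
    ≡⟨ cong (_++ s ∷ []) (reverse-++ (replicate q k) (bin j)) ⟩
  (reverse (bin j) ++ reverse (replicate q k)) ++ s ∷ []
    ≡⟨ cong₂ (λ B R → (B ++ R) ++ s ∷ []) (reverse-bin j) (reverse-replicate q k) ⟩
  (bin j ++ replicate q k) ++ s ∷ []
    ≡⟨ ++-assoc (bin j) (replicate q k) (s ∷ []) ⟩
  bin j ++ replicate q k ++ s ∷ [] ∎

Xc-reverse-Xʳ : ∀ k d r i → 1 ≤ d → 1 ≤ r → r ≤ k → i < k → Xc k d r i ≡ reverse (Xʳ k (k * d + r) i)
Xc-reverse-Xʳ k d r zero _ 1≤r r≤k _ =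
  sym (reverse-Xʳ k (k * d + r) 0 d r (cong (_+ r) (*-comm k d)) 1≤r r≤k)
Xc-reverse-Xʳ k d r (suc j) _ _ r≤k i<k with suc j <? r
... | yes i<r =
  sym (reverse-Xʳ k (k * d + r) (suc j) d (r ∸ suc j) l∸i (m<n⇒0<n∸m i<r) (≤-trans (m∸n≤m r (suc j)) r≤k))
  where
  l∸i : k * d + r ∸ suc j ≡ d * k + (r ∸ suc j)
  l∸i = trans (+-∸-assoc (k * d) (<⇒≤ i<r)) (cong (_+ (r ∸ suc j)) (*-comm k d))
Xc-reverse-Xʳ k (suc d) r (suc j) _ _ r≤k i<k | no i≮r =
  sym (reverse-Xʳ k (k * suc d + r) (suc j) d (k + r ∸ suc j) l∸i (m<n⇒0<n∸m i<k+r) k+r∸i≤k)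
  where
  i<k+r : suc j < k + r
  i<k+r = ≤-trans i<k (m≤m+n k r)
  k+r∸i≤k : k + r ∸ suc j ≤ k
  k+r∸i≤k =
    m≤n+o⇒m∸n≤o (k + r) (suc j) (subst (k + r ≤_) (+-comm k (suc j)) (+-monoʳ-≤ k (≮⇒≥ i≮r)))
  l∸i : k * suc d + r ∸ suc j ≡ d * k + (k + r ∸ suc j)
  l∸i = trans (cong (_∸ suc j) (regroup k d r)) (+-∸-assoc (d * k) (<⇒≤ i<k+r))
    where
    regroup : ∀ k d r → k * suc d + r ≡ d * k + (k + r)
    regroup = solve-∀

Xʳ-drain : ∀ k l → 1 ≤ k → k ≤ l → ∀ j n → j + n ≤ l →
  iter n (φʳ k) (Xʳ k l (j + n)) ≡ Xʳ k l j
Xʳ-drain k l 1≤k k≤l j n j+n≤l with o , refl ← m≤n⇒∃[o]m+o≡n j+n≤l = begin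
  iter n (φʳ k) (pack k (j + n + o ∸ (j + n)) ++ bin (j + n))
    ≡⟨ cong (λ m → iter n (φʳ k) (pack k m ++ bin (j + n))) (m+n∸m≡n (j + n) o) ⟩
  iter n (φʳ k) (pack k o ++ bin (j + n))
    ≡⟨ drain k 1≤k o j n (subst (k ≤_) (+-comm (j + n) o) k≤l) ⟩
  pack k (o + n) ++ bin j
    ≡⟨ cong (λ m → pack k m ++ bin j) (sym (regroup j n o)) ⟩
  pack k (j + n + o ∸ j) ++ bin j ∎
  where
  regroup : ∀ j n o → j + n + o ∸ j ≡ o + n
  regroup j n o = trans (cong (_∸ j) (+-assoc j n o)) (trans (m+n∸m≡n j (n + o)) (+-comm n o))

Xʳ-k : ∀ k l → 1 ≤ k → k ≤ l → Xʳ k l k ≡ Xʳ k l 0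
Xʳ-k (suc k) l 1≤k k≤l = begin
  pack (suc k) (l ∸ suc k) ++ suc k ∷ [] ≡⟨ sym (pack-+k (suc k) 1≤k (l ∸ suc k)) ⟩
  pack (suc k) (l ∸ suc k + suc k)       ≡⟨ cong (pack (suc k)) (m∸n+n≡m k≤l) ⟩
  pack (suc k) l                         ≡⟨ sym (++-identityʳ (pack (suc k) l)) ⟩
  pack (suc k) l ++ []                   ∎

-- The X_j are indexed mod k: i moves take X_i to X_0 = X_k, and g more moves to X_(k-g).
Xʳ-cycle : ∀ k l → 1 ≤ k → k ≤ l → ∀ r i g → k ≡ r + (i + g) →
  iter (k ∸ r) (φʳ k) (Xʳ k l i) ≡ Xʳ k l (r + i)
Xʳ-cycle k l 1≤k k≤l r i g refl = begin
  iter (r + (i + g) ∸ r) (φʳ k) (Xʳ k l i)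
    ≡⟨ cong (λ n → iter n (φʳ k) (Xʳ k l i)) (trans (m+n∸m≡n r (i + g)) (+-comm i g)) ⟩
  iter (g + i) (φʳ k) (Xʳ k l (0 + i))
    ≡⟨ iter-+ g i (φʳ k) _ ⟩
  iter g (φʳ k) (iter i (φʳ k) (Xʳ k l (0 + i)))
    ≡⟨ cong (iter g (φʳ k)) (Xʳ-drain k l 1≤k k≤l 0 i (≤-trans (m≤m+n i g) (≤-trans (m≤n+m (i + g) r) k≤l))) ⟩
  iter g (φʳ k) (Xʳ k l 0)
    ≡⟨ cong (iter g (φʳ k)) (trans (sym (Xʳ-k k l 1≤k k≤l)) (cong (Xʳ k l) (sym (+-assoc r i g)))) ⟩
  iter g (φʳ k) (Xʳ k l (r + i + g))
    ≡⟨ Xʳ-drain k l 1≤k k≤l (r + i) g (subst (_≤ l) (sym (+-assoc r i g)) k≤l) ⟩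
  Xʳ k l (r + i) ∎

-- If b < k the packing grows out of the rightmost bin; otherwise the leftmost bin is first drained
-- behind b, which then serves as the leftmost bin.
Xʳ-from-two-bins : ∀ k l b a → 1 ≤ k → k ≤ l → 1 ≤ b → b + a ≡ l →
  iter (l ∸ k) (φʳ k) (b ∷ bin a) ≡ Xʳ k l (k ∸ b)
Xʳ-from-two-bins k l b a 1≤k k≤l 1≤b b+a≡l with b <? k
... | yes b<k with c , refl ← m≤n⇒∃[o]m+o≡n (<⇒≤ b<k)
              with n , refl ← m≤n⇒∃[o]m+o≡n k≤l = begin
  iter (b + c + n ∸ (b + c)) (φʳ k) (b ∷ bin a)
    ≡⟨ cong₂ (λ m R → iter m (φʳ k) R) (m+n∸m≡n (b + c) n)
             (cong₂ _++_ (sym (pack-small k b 1≤b (<⇒≤ b<k))) (cong bin a≡c+n)) ⟩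
  iter n (φʳ k) (pack k b ++ bin (c + n))
    ≡⟨ drain k 1≤k b c n (+-monoʳ-≤ b (m≤m+n c n)) ⟩
  pack k (b + n) ++ bin c
    ≡⟨ cong₂ (λ m j → pack k m ++ bin j) (sym (b+c+n∸c b c n)) (sym (m+n∸m≡n b c)) ⟩
  Xʳ k (b + c + n) (b + c ∸ b) ∎
  where
  a≡c+n : a ≡ c + n
  a≡c+n = +-cancelˡ-≡ b a (c + n) (trans b+a≡l (+-assoc b c n))
  b+c+n∸c : ∀ b c n → b + c + n ∸ (b + c ∸ b) ≡ b + n
  b+c+n∸c b c n = trans (cong₂ _∸_ (swap b c n) (m+n∸m≡n b c)) (m+n∸n≡m (b + n) c)
    where
    swap : ∀ b c n → b + c + n ≡ b + n + c
    swap = solve-∀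
Xʳ-from-two-bins k@(suc _) l b a 1≤k k≤l _ refl | no b≮k with w , refl ← m≤n⇒∃[o]m+o≡n (≮⇒≥ b≮k) = begin
  iter (k + w + a ∸ k) (φʳ k) ((k + w) ∷ bin a)
    ≡⟨ cong (λ m → iter m (φʳ k) ((k + w) ∷ bin a)) l∸k≡w+a ⟩
  iter (w + a) (φʳ k) (pack k 0 ++ (k + w) ∷ bin (0 + a))
    ≡⟨ iter-+ w a (φʳ k) _ ⟩
  iter w (φʳ k) (iter a (φʳ k) (pack k 0 ++ (k + w) ∷ bin (0 + a)))
    ≡⟨ cong (iter w (φʳ k)) (drain-behind k 1≤k 0 (k + w) 0 a (m≤m+n k w)) ⟩
  iter w (φʳ k) (pack k a ++ bin (k + w))
    ≡⟨ drain k 1≤k a k w (≤-trans (m≤m+n k w) (m≤n+m (k + w) a)) ⟩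
  pack k (a + w) ++ bin k
    ≡⟨ cong (λ m → pack k m ++ bin k) (sym (trans l∸k≡w+a (+-comm w a))) ⟩
  Xʳ k (k + w + a) k
    ≡⟨ Xʳ-k k (k + w + a) 1≤k k≤l ⟩
  Xʳ k (k + w + a) 0
    ≡⟨ cong (Xʳ k (k + w + a)) (sym (m≤n⇒m∸n≡0 (m≤m+n k w))) ⟩
  Xʳ k (k + w + a) (k ∸ (k + w)) ∎
  where
  l∸k≡w+a : k + w + a ∸ k ≡ w + a
  l∸k≡w+a = trans (cong (_∸ k) (+-assoc k w a)) (m+n∸m≡n k (w + a))

-- At i = k - r (g = 0) f uses its second formula, which gives the same value there.
f-low : ∀ d r i g → let k = r + (i + g) in f k (k * d + r) d r i ≡ k ∸ (d * (r + g) + r)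
f-low d r i g with i <? r + (i + g) ∸ r
... | yes _ = begin
  (k + d * i) ∸ (k * d + r)                   ≡⟨ cong₂ _∸_ (+-comm k (d * i)) (split d r i g) ⟩
  (d * i + k) ∸ (d * i + (d * (r + g) + r))   ≡⟨ [m+n]∸[m+o]≡n∸o (d * i) k (d * (r + g) + r) ⟩
  k ∸ (d * (r + g) + r) ∎
  where
  k = r + (i + g)
  split : ∀ d r i g → (r + (i + g)) * d + r ≡ d * i + (d * (r + g) + r)
  split = solve-∀
f-low d r i zero | no _ =
  cong (r + (i + 0) ∸_) (trans (cong (λ x → suc d * (x ∸ i)) (cong (r +_) (+-identityʳ i)))
                               (trans (cong (suc d *_) (m+n∸n≡m r i)) (regroup d r)))
  where
  regroup : ∀ d r → suc d * r ≡ d * (r + 0) + r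
  regroup = solve-∀
f-low d r i (suc g) | no i≮k∸r =
  contradiction (subst (i <_) (sym (m+n∸m≡n r (i + suc g))) (m<m+n i 0<1+n)) i≮k∸r

f-high : ∀ d j e n → let r = suc j + e ; k = r + n ; i = suc n + j in
  f k (k * d + r) d r i ≡ k ∸ (suc d * e)
f-high d j e n with suc n + j <? suc j + e + n ∸ (suc j + e)
... | yes i<k∸r = contradiction (subst (suc n + j <_) (m+n∸m≡n (suc j + e) n) i<k∸r)
                                (≤⇒≯ (≤-trans (n≤1+n n) (m≤m+n (suc n) j)))
... | no _      = cong (λ x → suc j + e + n ∸ suc d * x)
                       (trans (cong (_∸ (suc n + j)) (regroup j e n)) (m+n∸n≡m e (suc n + j)))
  where
  regroup : ∀ j e n → suc j + e + n ≡ e + (suc n + j)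
  regroup = solve-∀

f<k : ∀ k d r i → 1 ≤ r → i < k → f k (k * d + r) d r i < k
f<k k d r i 1≤r i<k with i <? k ∸ r
... | yes _ = m<n+o⇒m∸n<o (k + d * i) (k * d + r) {{>-nonZero (≤-<-trans z≤n i<k)}}
                (subst (_< k * d + r + k) (+-comm (d * i) k) (+-mono-<-≤ di<kd+r ≤-refl))
  where
  di<kd+r : d * i < k * d + r
  di<kd+r = ≤-<-trans (subst (d * i ≤_) (*-comm d k) (*-monoʳ-≤ d (<⇒≤ i<k))) (m<m+n (k * d) 1≤r)
... | no _  = m∸n<m (≤-<-trans z≤n i<k) (≤-trans (m<n⇒0<n∸m i<k) (m≤m+n (k ∸ i) (d * (k ∸ i))))

Ψʳ : (k l d r : ℕ) → List ℕ → List ℕ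
Ψʳ k l d r R = iter (l ∸ k) (φʳ k) (iter (d * r + k * triangular d) (φʳ l) (iter (k ∸ r) (φʳ k) R))

Ψ-reverse : ∀ k l d r R → Ψ k l d r (reverse R) ≡ reverse (Ψʳ k l d r R)
Ψ-reverse k l d r R = begin
  iter (l ∸ k) (φ k) (iter N (φ l) (iter (k ∸ r) (φ k) (reverse R)))
    ≡⟨ cong (λ X → iter (l ∸ k) (φ k) (iter N (φ l) X)) (iter-φ-reverse k (k ∸ r) R) ⟩
  iter (l ∸ k) (φ k) (iter N (φ l) (reverse (iter (k ∸ r) (φʳ k) R)))
    ≡⟨ cong (iter (l ∸ k) (φ k)) (iter-φ-reverse l N (iter (k ∸ r) (φʳ k) R)) ⟩
  iter (l ∸ k) (φ k) (reverse (iter N (φʳ l) (iter (k ∸ r) (φʳ k) R)))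
    ≡⟨ iter-φ-reverse k (l ∸ k) (iter N (φʳ l) (iter (k ∸ r) (φʳ k) R)) ⟩
  reverse (iter (l ∸ k) (φʳ k) (iter N (φʳ l) (iter (k ∸ r) (φʳ k) R)))
    ≡⟨ cong (λ T → reverse (iter (l ∸ k) (φʳ k) (iter (d * r + k * T) (φʳ l) (iter (k ∸ r) (φʳ k) R))))
            (half-pronic d) ⟩
  reverse (Ψʳ k l d r R) ∎
  where
  N = d * r + k * (d * (d ∸ 1) / 2)

k≤k*[1+d]+r : ∀ k d r → k ≤ k * suc d + r
k≤k*[1+d]+r k d r = ≤-trans (m≤m*n k (suc d)) (m≤m+n (k * suc d) r)

-- Here g = k - r - i.
pour-low : ∀ d r i g → 1 ≤ r → let k = r + (i + g) ; l = k * suc d + r in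
  iter (suc d * r + k * triangular (suc d)) (φʳ l) (Xʳ k l (r + i))
    ≡ (suc d * (r + g) + r) ∷ bin (suc d * i)
pour-low d (suc r) i g _ = begin
  iter N (φʳ l) (pack k (l ∸ (suc r + i)) ++ bin (suc r + i))
    ≡⟨ cong (λ P → iter N (φʳ l) (P ++ bin (suc r + i))) packed ⟩
  iter N (φʳ l) ((suc r + g) ∷ replicate d k ++ suc (r + i) ∷ [])
    ≡⟨ cong (λ m → iter m (φʳ l) ((suc r + g) ∷ replicate d k ++ suc (r + i) ∷ []))
            (count d r i g (triangular d)) ⟩
  iter (t + (d * suc (r + i) + k * triangular d)) (φʳ l)
       ((suc r + g) ∷ replicate d k ++ suc (r + i) ∷ [])
    ≡⟨ pour-onto-rightmost (suc r + g) k d (r + i) t (suc d * i) (total d r i g) (remainder d r i g) ⟩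
  (suc r + g + t) ∷ bin (suc d * i)
    ≡⟨ cong (λ b → b ∷ bin (suc d * i)) (front d r g) ⟩
  (suc d * (suc r + g) + suc r) ∷ bin (suc d * i) ∎
  where
  k = suc r + (i + g)
  l = k * suc d + suc r
  N = suc d * suc r + k * triangular (suc d)
  t = suc r + d * (suc r + g)
  packed : pack k (l ∸ (suc r + i)) ≡ (suc r + g) ∷ replicate d k
  packed = trans (cong (pack k) (trans (cong (_∸ (suc r + i)) (split d r i g))
                                       (m+n∸n≡m (d * k + (suc r + g)) (suc r + i))))
                 (pack-full k d (suc r + g) (s≤s z≤n) (+-monoʳ-≤ (suc r) (m≤n+m g i)))
    where
    split : ∀ d r i g →
      (suc r + (i + g)) * suc d + suc r ≡ d * (suc r + (i + g)) + (suc r + g) + (suc r + i)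
    split = solve-∀
  count : ∀ d r i g T → suc d * suc r + (suc r + (i + g)) * (d + T)
                        ≡ suc r + d * (suc r + g) + (d * suc (r + i) + (suc r + (i + g)) * T)
  count = solve-∀
  total : ∀ d r i g →
    suc r + g + (d * (suc r + (i + g)) + suc (r + i)) ≡ (suc r + (i + g)) * suc d + suc r
  total = solve-∀
  remainder : ∀ d r i g → suc r + d * (suc r + g) + suc d * i ≡ d * (suc r + (i + g)) + suc (r + i)
  remainder = solve-∀
  front : ∀ d r g → suc r + g + (suc r + d * (suc r + g)) ≡ suc d * (suc r + g) + suc r
  front = solve-∀

Ψʳ-Xʳ-low : ∀ d r i g → 1 ≤ r → let k = r + (i + g) ; l = k * suc d + r in
  Ψʳ k l (suc d) r (Xʳ k l i) ≡ Xʳ k l (f k l (suc d) r i)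
Ψʳ-Xʳ-low d r i g 1≤r = begin
  iter (l ∸ k) (φʳ k) (iter N (φʳ l) (iter (k ∸ r) (φʳ k) (Xʳ k l i)))
    ≡⟨ cong (λ R → iter (l ∸ k) (φʳ k) (iter N (φʳ l) R)) (Xʳ-cycle k l 1≤k k≤l r i g refl) ⟩
  iter (l ∸ k) (φʳ k) (iter N (φʳ l) (Xʳ k l (r + i)))
    ≡⟨ cong (iter (l ∸ k) (φʳ k)) (pour-low d r i g 1≤r) ⟩
  iter (l ∸ k) (φʳ k) (b ∷ bin (suc d * i))
    ≡⟨ Xʳ-from-two-bins k l b (suc d * i) 1≤k k≤l (≤-trans 1≤r (m≤n+m r _)) (total d r i g) ⟩
  Xʳ k l (k ∸ b)
    ≡⟨ cong (Xʳ k l) (sym (f-low (suc d) r i g)) ⟩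
  Xʳ k l (f k l (suc d) r i) ∎
  where
  k = r + (i + g)
  l = k * suc d + r
  N = suc d * r + k * triangular (suc d)
  b = suc d * (r + g) + r
  1≤k = ≤-trans 1≤r (m≤m+n r (i + g))
  k≤l = k≤k*[1+d]+r k d r
  total : ∀ d r i g → suc d * (r + g) + r + suc d * i ≡ (r + (i + g)) * suc d + r
  total = solve-∀

-- Here n = k - r, e = k - i and suc j = i + r - k, for i = suc n + j.
pour-high : ∀ d j e n → 1 ≤ e → let r = suc j + e ; k = r + n ; l = k * d + r in
  iter (d * r + k * triangular d) (φʳ l) (Xʳ k l (suc j)) ≡ (suc d * e) ∷ bin (d * (suc n + j) + suc j)
pour-high d j e n 1≤e = begin
  iter N (φʳ l) (pack k (l ∸ suc j) ++ suc j ∷ [])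
    ≡⟨ cong₂ (λ m P → iter m (φʳ l) (P ++ suc j ∷ [])) (count d j e n (triangular d)) packed ⟩
  iter (d * e + (d * suc j + k * triangular d)) (φʳ l) (e ∷ replicate d k ++ suc j ∷ [])
    ≡⟨ pour-onto-rightmost e k d j (d * e) (d * (suc n + j) + suc j) (total d j e n)
                           (remainder d j e n) ⟩
  (suc d * e) ∷ bin (d * (suc n + j) + suc j) ∎
  where
  r = suc j + e
  k = r + n
  l = k * d + r
  N = d * r + k * triangular d
  packed : pack k (l ∸ suc j) ≡ e ∷ replicate d k
  packed = trans (cong (pack k) (trans (cong (_∸ suc j) (split d j e n))
                                       (m+n∸n≡m (d * k + e) (suc j))))
                 (pack-full k d e 1≤e (≤-trans (m≤n+m e (suc j)) (m≤m+n r n)))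
    where
    split : ∀ d j e n → (suc j + e + n) * d + (suc j + e) ≡ d * (suc j + e + n) + e + suc j
    split = solve-∀
  count : ∀ d j e n T →
    d * (suc j + e) + (suc j + e + n) * T ≡ d * e + (d * suc j + (suc j + e + n) * T)
  count = solve-∀
  total : ∀ d j e n → e + (d * (suc j + e + n) + suc j) ≡ (suc j + e + n) * d + (suc j + e)
  total = solve-∀
  remainder : ∀ d j e n → d * e + (d * (suc n + j) + suc j) ≡ d * (suc j + e + n) + suc j
  remainder = solve-∀

Ψʳ-Xʳ-high : ∀ d j e n → 1 ≤ e →
  let r = suc j + e ; k = r + n ; l = k * suc d + r ; i = suc n + j in
  Ψʳ k l (suc d) r (Xʳ k l i) ≡ Xʳ k l (f k l (suc d) r i)
Ψʳ-Xʳ-high d j e n 1≤e = begin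
  iter (l ∸ k) (φʳ k) (iter N (φʳ l) (iter (k ∸ r) (φʳ k) (Xʳ k l (suc n + j))))
    ≡⟨ cong (λ R → iter (l ∸ k) (φʳ k) (iter N (φʳ l) R)) turn ⟩
  iter (l ∸ k) (φʳ k) (iter N (φʳ l) (Xʳ k l (suc j)))
    ≡⟨ cong (iter (l ∸ k) (φʳ k)) (pour-high (suc d) j e n 1≤e) ⟩
  iter (l ∸ k) (φʳ k) (b ∷ bin a)
    ≡⟨ Xʳ-from-two-bins k l b a (s≤s z≤n) k≤l (≤-trans 1≤e (m≤m+n e _)) (total d j e n) ⟩
  Xʳ k l (k ∸ b)
    ≡⟨ cong (Xʳ k l) (sym (f-high (suc d) j e n)) ⟩
  Xʳ k l (f k l (suc d) r (suc n + j)) ∎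
  where
  r = suc j + e
  k = r + n
  l = k * suc d + r
  N = suc d * r + k * triangular (suc d)
  b = suc (suc d) * e
  a = suc d * (suc n + j) + suc j
  k≤l = k≤k*[1+d]+r k d r
  turn : iter (k ∸ r) (φʳ k) (Xʳ k l (suc n + j)) ≡ Xʳ k l (suc j)
  turn = trans (cong₂ (λ m i → iter m (φʳ k) (Xʳ k l i)) (m+n∸m≡n r n) (cong suc (+-comm n j)))
               (Xʳ-drain k l (s≤s z≤n) k≤l (suc j) n (≤-trans (+-monoˡ-≤ n (m≤m+n (suc j) e)) k≤l))
  total : ∀ d j e n →
    suc (suc d) * e + (suc d * (suc n + j) + suc j) ≡ (suc j + e + n) * suc d + (suc j + e)
  total = solve-∀

Ψʳ-Xʳ : ∀ k d r i → 1 ≤ d → 1 ≤ r → r ≤ k → i < k →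
  Ψʳ k (k * d + r) d r (Xʳ k (k * d + r) i) ≡ Xʳ k (k * d + r) (f k (k * d + r) d r i)
Ψʳ-Xʳ k (suc d) r i _ 1≤r r≤k i<k with n , refl ← m≤n⇒∃[o]m+o≡n r≤k with i ≤? n
... | yes i≤n with g , refl ← m≤n⇒∃[o]m+o≡n i≤n = Ψʳ-Xʳ-low d r i g 1≤r
... | no i≰n with j , refl ← m≤n⇒∃[o]m+o≡n (≰⇒> i≰n)
             with e , eq ← m≤n⇒∃[o]m+o≡n (+-cancelʳ-< n (suc j) r
                                             (subst (_< r + n) (cong suc (+-comm n j)) i<k))
             with refl ← trans (+-suc (suc j) e) eq = Ψʳ-Xʳ-high d j (suc e) n (s≤s z≤n)

lemma2 : (k l d r : ℕ) → 2 ≤ k → k < l → 1 ≤ d → 1 ≤ r → r ≤ k →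
    l ≡ k * d + r → (i : ℕ) → i < k →
    Ψ k l d r (Xc k d r i) ≡ Xc k d r (f k l d r i)
lemma2 k .(k * d + r) d r _ _ 1≤d 1≤r r≤k refl i i<k = begin
  Ψ k l d r (Xc k d r i)              ≡⟨ cong (Ψ k l d r) (Xc-reverse-Xʳ k d r i 1≤d 1≤r r≤k i<k) ⟩
  Ψ k l d r (reverse (Xʳ k l i))      ≡⟨ Ψ-reverse k l d r (Xʳ k l i) ⟩
  reverse (Ψʳ k l d r (Xʳ k l i))     ≡⟨ cong reverse (Ψʳ-Xʳ k d r i 1≤d 1≤r r≤k i<k) ⟩
  reverse (Xʳ k l (f k l d r i))      ≡⟨ sym (Xc-reverse-Xʳ k d r (f k l d r i) 1≤d 1≤r r≤k
                                                             (f<k k d r i 1≤r i<k)) ⟩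
  Xc k d r (f k l d r i) ∎
  where
  l = k * d + r
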